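{- Let $l,s$ be positive integers and $P=\{1,\dots,ls+1\}$. For each $i\in P$ let $\{B_{i1},\dots,B_{is}\}$ be a partition of $P\setminus\{i\}$ into $s$ blocks, each of size $l$. Let $D_1$ be the directed graph with vertex set $V=\{(i,B_{ig}): 1\le i\le ls+1,\ 1\le g\le s\}$ and an arc $(i,B_{ig})\to(j,B_{jh})$ if and only if $i\in B_{jh}$. Then $D_1$ is a directed strongly regular graph with parameters \[(v,k,t,\lambda,\mu)=\big(ls^2+s,\ ls,\ l,\ l-1,\ l\big).\]
   Context: A directed strongly regular graph with parameters $(v,k,t,\lambda,\mu)$ is a loopless directed graph on $v$ vertices with adjacency matrix $A$ satisfying $AJ=JA=kJ$ and $A^2=tI+\lambda A+\mu(J-I-A)$, where $I$ is the identity and $J$ the all-ones matrix. -}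

module Defs where

open import Data.Nat using (ℕ; zero; suc)
open import Data.Integer using (ℤ; +_; _+_; _-_; _*_)
open import Data.Fin using (Fin; zero; suc; _≟_)
open import Data.Bool using (Bool; true; false; if_then_else_)
open import Data.Product using (Σ; _×_; _,_)
open import Relation.Nullary using (¬_; does)
open import Relation.Binary.PropositionalEquality using (_≡_)
open import Function.Bundles using (_↔_; Inverse)

sumFin : {n : ℕ} → (Fin n → ℤ) → ℤ
sumFin {zero}  f = + 0
sumFin {suc n} f = f zero + sumFin {n} (λ i → f (suc i))

countFin : {n : ℕ} → (Fin n → Bool) → ℕ
countFin {zero}  p = 0
countFin {suc n} p = (if p zero then 1 else 0) Data.Nat.+ countFin {n} (λ i → p (suc i))

Mat : ℕ → Set
Mat v = Fin v → Fin v → ℤ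

_⊕_ : {v : ℕ} → Mat v → Mat v → Mat v
(A ⊕ B) x y = A x y + B x y

_⊖_ : {v : ℕ} → Mat v → Mat v → Mat v
(A ⊖ B) x y = A x y - B x y

_⊛_ : {v : ℕ} → Mat v → Mat v → Mat v
(A ⊛ B) x y = sumFin (λ z → A x z * B z y)

_·_ : {v : ℕ} → ℤ → Mat v → Mat v
(c · A) x y = c * A x y

infixl 6 _⊕_ _⊖_
infixl 7 _⊛_ _·_

IMat : (v : ℕ) → Mat v
IMat v x y = if does (x ≟ y) then + 1 else + 0

JMat : (v : ℕ) → Mat v
JMat v x y = + 1

_≈ᴹ_ : {v : ℕ} → Mat v → Mat v → Set
A ≈ᴹ B = ∀ x y → A x y ≡ B x y

adjMat : {v : ℕ} → (Fin v → Fin v → Bool) → Mat v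
adjMat adj x y = if adj x y then + 1 else + 0

IsDSRG : (v k t λ' μ : ℕ) → (Fin v → Fin v → Bool) → Set
IsDSRG v k t λ' μ adj =
  (∀ x → adj x x ≡ false) ×
  ((A ⊛ JMat v) ≈ᴹ ((+ k) · JMat v)) ×
  ((JMat v ⊛ A) ≈ᴹ ((+ k) · JMat v)) ×
  ((A ⊛ A) ≈ᴹ ((+ t) · IMat v ⊕ (+ λ') · A ⊕ (+ μ) · (JMat v ⊖ IMat v ⊖ A)))
  where
    A : Mat v
    A = adjMat adj

-- A directed graph on an arbitrary vertex type V (relation adj) is a DSRG with
-- parameters (v,k,t,λ,μ) if, for some enumeration Fin v ↔ V of its vertices, the
-- transported relation on Fin v is a DSRG (i.e. |V| = v and A satisfies the identities).
IsDSRGOn : (V : Set) → (V → V → Bool) → (v k t λ' μ : ℕ) → Set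
IsDSRGOn V adj v k t λ' μ =
  Σ (Fin v ↔ V) λ e → IsDSRG v k t λ' μ (λ x y → adj (Inverse.to e x) (Inverse.to e y))

-- P = Fin n with n = l s + 1.  For each i, the partition
-- {B_i1,…,B_is} of P∖{i} is encoded by blk i : Fin n → Fin s, where
-- B_ig = { j | j ≠ i and blk i j = g } (the value blk i i is irrelevant).
inBlock : {n s : ℕ} → (Fin n → Fin n → Fin s) → Fin n → Fin s → Fin n → Bool
inBlock blk i g j = Data.Bool._∧_ (Data.Bool.not (does (j ≟ i))) (does (blk i j ≟ g))

D₁ : {n s : ℕ} → (Fin n → Fin n → Fin s) → (Fin n × Fin s) → (Fin n × Fin s) → Bool
D₁ blk (i , g) (j , h) = inBlock blk j h i

module Submission where

-- Write A for the adjacency matrix of D₁ and n = ls + 1.  The arc relation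
-- (i,g) → (j,h) is "i ≠ j and blk j i = h"; since blk j i is a single block,
-- every vertex (i,g) has exactly one out-neighbour (j, blk j i) above each
-- point j ≠ i.  Hence, for every weight w on the points,
--     ∑_(j,h) A((i,g),(j,h)) · w j  =  ∑_j w j − w i            (out-sums)
-- and dually ∑_(i,g) A((i,g),(k,f)) = s · |B_kf|                  (in-sums).
-- With w = 1 the first gives out-degree n − 1 = ls; the second gives
-- in-degree s·l = ls; and with w j = [j ∈ B_kf] (which is A(z,(k,f)) for z
-- above j) it gives A²(x,y) = l − A(x,y) = l·I + (l−1)·A + l·(J − I − A).

open import Defs
open import Data.Nat using (ℕ; zero; suc; _+_; _*_; _∸_; _≤_)
import Data.Nat.Properties as ℕP
open import Data.Integer using (ℤ; +_) renaming (_+_ to _+ℤ_; _*_ to _*ℤ_; _-_ to _-ℤ_)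
import Data.Integer.Properties as ℤP
open import Data.Integer.Tactic.RingSolver using (solve-∀)
open import Data.Fin using (Fin; zero; suc; _≟_; _↑ˡ_; _↑ʳ_; remQuot; combine)
open import Data.Fin.Properties using (remQuot-combine; *↔×)
open import Data.Bool using (Bool; true; false; not; _∧_; if_then_else_)
open import Data.Product using (_×_; _,_)
open import Function using (_∘_)
open import Relation.Nullary using (does; yes; no)
open import Relation.Nullary.Negation using (contradiction)
open import Relation.Binary.PropositionalEquality
  using (_≡_; refl; sym; trans; cong; cong₂; subst; module ≡-Reasoning)
open import Algebra.Properties.Semiring.Sum ℤP.+-*-semiring
  using (sum; sum-syntax; sum-cong-≗; *-distribˡ-sum)

sumFin≡sum : ∀ {n} (f : Fin n → ℤ) → sumFin f ≡ sum f
sumFin≡sum {zero}  f = refl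
sumFin≡sum {suc n} f = cong (f zero +ℤ_) (sumFin≡sum (f ∘ suc))

∑-const : ∀ n (c : ℤ) → ∑[ i < n ] c ≡ + n *ℤ c
∑-const zero    c = sym (ℤP.*-zeroˡ c)
∑-const (suc n) c = begin
  c +ℤ ∑[ i < n ] c     ≡⟨ cong (c +ℤ_) (∑-const n c) ⟩
  c +ℤ + n *ℤ c         ≡⟨ cong (_+ℤ + n *ℤ c) (sym (ℤP.*-identityˡ c)) ⟩
  + 1 *ℤ c +ℤ + n *ℤ c  ≡⟨ sym (ℤP.*-distribʳ-+ c (+ 1) (+ n)) ⟩
  + suc n *ℤ c          ∎
  where open ≡-Reasoning

∑-↑ : ∀ m n (f : Fin (m + n) → ℤ) →
  sum f ≡ ∑[ i < m ] f (i ↑ˡ n) +ℤ ∑[ j < n ] f (m ↑ʳ j)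
∑-↑ zero    n f = sym (ℤP.+-identityˡ _)
∑-↑ (suc m) n f = trans (cong (f zero +ℤ_) (∑-↑ m n (f ∘ suc))) (sym (ℤP.+-assoc (f zero) _ _))

∑-combine : ∀ m n (f : Fin (m * n) → ℤ) →
  sum f ≡ ∑[ i < m ] ∑[ j < n ] f (combine i j)
∑-combine zero    n f = refl
∑-combine (suc m) n f =
  trans (∑-↑ n (m * n) f) (cong (sum (λ j → f (j ↑ˡ (m * n))) +ℤ_) (∑-combine m n (f ∘ (n ↑ʳ_))))

∑-pairs : ∀ m n (G : Fin m × Fin n → ℤ) →
  sumFin {m * n} (G ∘ remQuot n) ≡ ∑[ i < m ] ∑[ j < n ] G (i , j)
∑-pairs m n G = begin
  sumFin (G ∘ remQuot n)                          ≡⟨ sumFin≡sum (G ∘ remQuot n) ⟩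
  sum (G ∘ remQuot n)                             ≡⟨ ∑-combine m n (G ∘ remQuot n) ⟩
  ∑[ i < m ] ∑[ j < n ] G (remQuot n (combine i j)) ≡⟨ sum-cong-≗ (λ i → sum-cong-≗ (λ j →
                                                        cong G (remQuot-combine i j))) ⟩
  ∑[ i < m ] ∑[ j < n ] G (i , j)                 ∎
  where open ≡-Reasoning

ι : Bool → ℤ
ι b = if b then + 1 else + 0

∑-count : ∀ {n} (p : Fin n → Bool) → ∑[ i < n ] ι (p i) ≡ + countFin p
∑-count {zero}  p = refl
∑-count {suc n} p = begin
  ι (p zero) +ℤ sum (ι ∘ p ∘ suc)                  ≡⟨ cong (ι (p zero) +ℤ_) (∑-count (p ∘ suc)) ⟩
  ι (p zero) +ℤ + countFin (p ∘ suc)                ≡⟨ cong (_+ℤ + countFin (p ∘ suc)) (ι≡+ (p zero)) ⟩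
  + (if p zero then 1 else 0) +ℤ + countFin (p ∘ suc) ≡⟨ sym (ℤP.pos-+ _ (countFin (p ∘ suc))) ⟩
  + countFin p                                      ∎
  where
  open ≡-Reasoning
  ι≡+ : ∀ b → ι b ≡ + (if b then 1 else 0)
  ι≡+ true  = refl
  ι≡+ false = refl

ι-∧ : ∀ b d (w : ℤ) → ι (b ∧ d) *ℤ w ≡ ι d *ℤ (ι b *ℤ w)
ι-∧ true  d w = cong (ι d *ℤ_) (sym (ℤP.*-identityˡ w))
ι-∧ false d w = trans (ℤP.*-zeroˡ w) (sym (ℤP.*-zeroʳ (ι d)))

∑-δ : ∀ {n} (i : Fin n) (w : Fin n → ℤ) → ∑[ j < n ] (ι (does (i ≟ j)) *ℤ w j) ≡ w i
∑-δ {suc n} zero w = begin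
  + 1 *ℤ w zero +ℤ ∑[ j < n ] (+ 0 *ℤ w (suc j)) ≡⟨ cong₂ _+ℤ_ (ℤP.*-identityˡ (w zero))
                                                    (sum-cong-≗ (λ j → ℤP.*-zeroˡ (w (suc j)))) ⟩
  w zero +ℤ ∑[ j < n ] (+ 0)                   ≡⟨ cong (w zero +ℤ_) (trans (∑-const n (+ 0)) (ℤP.*-zeroʳ (+ n))) ⟩
  w zero +ℤ + 0                               ≡⟨ ℤP.+-identityʳ (w zero) ⟩
  w zero                                      ∎
  where open ≡-Reasoning
∑-δ {suc n} (suc i) w = begin
  + 0 *ℤ w zero +ℤ ∑[ j < n ] (ι (does (i ≟ j)) *ℤ w (suc j)) ≡⟨ cong (_+ℤ rest) (ℤP.*-zeroˡ (w zero)) ⟩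
  + 0 +ℤ rest                                                ≡⟨ ℤP.+-identityˡ rest ⟩
  rest                                                       ≡⟨ ∑-δ i (w ∘ suc) ⟩
  w (suc i)                                                  ∎
  where
  open ≡-Reasoning
  rest : ℤ
  rest = ∑[ j < n ] (ι (does (i ≟ j)) *ℤ w (suc j))

∑-δᶜ : ∀ {n} (i : Fin n) (w : Fin n → ℤ) →
  ∑[ j < n ] (ι (not (does (i ≟ j))) *ℤ w j) ≡ sum w -ℤ w i
∑-δᶜ {suc n} zero w = begin
  + 0 *ℤ w zero +ℤ ∑[ j < n ] (+ 1 *ℤ w (suc j)) ≡⟨ cong₂ _+ℤ_ (ℤP.*-zeroˡ (w zero))
                                                    (sum-cong-≗ (λ j → ℤP.*-identityˡ (w (suc j)))) ⟩
  + 0 +ℤ sum (w ∘ suc)                       ≡⟨ drop-first (w zero) (sum (w ∘ suc)) ⟩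
  sum w -ℤ w zero                            ∎
  where
  open ≡-Reasoning
  drop-first : ∀ a b → + 0 +ℤ b ≡ (a +ℤ b) -ℤ a
  drop-first = solve-∀
∑-δᶜ {suc n} (suc i) w = begin
  + 1 *ℤ w zero +ℤ ∑[ j < n ] (ι (not (does (i ≟ j))) *ℤ w (suc j))
      ≡⟨ cong₂ _+ℤ_ (ℤP.*-identityˡ (w zero)) (∑-δᶜ i (w ∘ suc)) ⟩
  w zero +ℤ (sum (w ∘ suc) -ℤ w (suc i)) ≡⟨ reassociate (w zero) (sum (w ∘ suc)) (w (suc i)) ⟩
  sum w -ℤ w (suc i)                    ∎
  where
  open ≡-Reasoning
  reassociate : ∀ a b c → a +ℤ (b -ℤ c) ≡ (a +ℤ b) -ℤ c
  reassociate = solve-∀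

module _ {n s : ℕ} (blk : Fin n → Fin n → Fin s) where

  D₁-irreflexive : ∀ x → D₁ blk x x ≡ false
  D₁-irreflexive (i , g) with i ≟ i
  ... | yes _   = refl
  ... | no i≢i = contradiction refl i≢i

  -- Out-sums: (i,g) has exactly one out-neighbour (j, blk j i) above each
  -- point j ≠ i, so weighting the out-neighbours by a function of their
  -- point sums that function over all points except i.
  ∑-out : ∀ i g (w : Fin n → ℤ) →
    ∑[ j < n ] ∑[ h < s ] (ι (D₁ blk (i , g) (j , h)) *ℤ w j) ≡ sum w -ℤ w i
  ∑-out i g w = begin
    ∑[ j < n ] ∑[ h < s ] (ι (j≠i j ∧ does (blk j i ≟ h)) *ℤ w j)
      ≡⟨ sum-cong-≗ (λ j → sum-cong-≗ (λ h → ι-∧ (j≠i j) (does (blk j i ≟ h)) (w j))) ⟩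
    ∑[ j < n ] ∑[ h < s ] (ι (does (blk j i ≟ h)) *ℤ (ι (j≠i j) *ℤ w j))
      ≡⟨ sum-cong-≗ (λ j → ∑-δ (blk j i) (λ _ → ι (j≠i j) *ℤ w j)) ⟩
    ∑[ j < n ] (ι (not (does (i ≟ j))) *ℤ w j)
      ≡⟨ ∑-δᶜ i w ⟩
    sum w -ℤ w i
      ∎
    where
    open ≡-Reasoning
    j≠i : Fin n → Bool
    j≠i j = not (does (i ≟ j))

  -- Out-degree: (i,g) has one out-neighbour above each of the n − 1 points j ≠ i.
  outDegree : ∀ x →
    sumFin {n * s} (λ z → ι (D₁ blk x (remQuot s z)) *ℤ + 1) ≡ + n -ℤ + 1
  outDegree (i , g) = begin
    sumFin (λ z → ι (D₁ blk (i , g) (remQuot s z)) *ℤ + 1)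
      ≡⟨ ∑-pairs n s (λ z → ι (D₁ blk (i , g) z) *ℤ + 1) ⟩
    ∑[ j < n ] ∑[ h < s ] (ι (D₁ blk (i , g) (j , h)) *ℤ + 1)
      ≡⟨ ∑-out i g (λ _ → + 1) ⟩
    (∑[ j < n ] (+ 1)) -ℤ + 1
      ≡⟨ cong (_-ℤ + 1) (trans (∑-const n (+ 1)) (ℤP.*-identityʳ (+ n))) ⟩
    + n -ℤ + 1
      ∎
    where open ≡-Reasoning

  -- In-degree: (i,g) → (k,f) holds iff i ∈ B_kf, independently of g, so the
  -- in-degree of (k,f) is s·|B_kf|.
  inDegree : ∀ k f →
    sumFin {n * s} (λ z → + 1 *ℤ ι (D₁ blk (remQuot s z) (k , f))) ≡ + s *ℤ + countFin (inBlock blk k f)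
  inDegree k f = begin
    sumFin (λ z → + 1 *ℤ ι (D₁ blk (remQuot s z) (k , f)))
      ≡⟨ ∑-pairs n s (λ z → + 1 *ℤ ι (D₁ blk z (k , f))) ⟩
    ∑[ i < n ] ∑[ g < s ] (+ 1 *ℤ ι (inBlock blk k f i))
      ≡⟨ sum-cong-≗ (λ i → trans (sum-cong-≗ {s} (λ _ → ℤP.*-identityˡ (ι (inBlock blk k f i))))
                                 (∑-const s (ι (inBlock blk k f i)))) ⟩
    ∑[ i < n ] (+ s *ℤ ι (inBlock blk k f i))
      ≡⟨ sym (*-distribˡ-sum (+ s) (ι ∘ inBlock blk k f)) ⟩
    + s *ℤ ∑[ i < n ] ι (inBlock blk k f i)
      ≡⟨ cong (+ s *ℤ_) (∑-count (inBlock blk k f)) ⟩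
    + s *ℤ + countFin (inBlock blk k f)
      ∎
    where open ≡-Reasoning

  -- Two-step paths: the middle vertex of a path x → z → (k,f) lies above a
  -- point of B_kf, and every point j ≠ i of B_kf carries exactly one such z,
  -- so A²(x,(k,f)) = |B_kf| − A(x,(k,f)).
  twoPaths : ∀ x k f →
    sumFin {n * s} (λ z → ι (D₁ blk x (remQuot s z)) *ℤ ι (D₁ blk (remQuot s z) (k , f)))
      ≡ + countFin (inBlock blk k f) -ℤ ι (D₁ blk x (k , f))
  twoPaths (i , g) k f = begin
    sumFin (λ z → ι (D₁ blk (i , g) (remQuot s z)) *ℤ ι (D₁ blk (remQuot s z) (k , f)))
      ≡⟨ ∑-pairs n s (λ z → ι (D₁ blk (i , g) z) *ℤ ι (D₁ blk z (k , f))) ⟩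
    ∑[ j < n ] ∑[ h < s ] (ι (D₁ blk (i , g) (j , h)) *ℤ ι (inBlock blk k f j))
      ≡⟨ ∑-out i g (ι ∘ inBlock blk k f) ⟩
    (∑[ j < n ] ι (inBlock blk k f j)) -ℤ ι (inBlock blk k f i)
      ≡⟨ cong (_-ℤ ι (inBlock blk k f i)) (∑-count (inBlock blk k f)) ⟩
    + countFin (inBlock blk k f) -ℤ ι (inBlock blk k f i)
      ∎
    where open ≡-Reasoning

squareRHS : ∀ l → 1 ≤ l → ∀ (I a : ℤ) →
  + l *ℤ I +ℤ + (l ∸ 1) *ℤ a +ℤ + l *ℤ ((+ 1 -ℤ I) -ℤ a) ≡ + l -ℤ a
squareRHS l 1≤l I a = begin
  + l *ℤ I +ℤ + (l ∸ 1) *ℤ a +ℤ + l *ℤ ((+ 1 -ℤ I) -ℤ a)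
    ≡⟨ cong (λ q → + l *ℤ I +ℤ q *ℤ a +ℤ + l *ℤ ((+ 1 -ℤ I) -ℤ a)) l∸1≡l-1 ⟩
  + l *ℤ I +ℤ (+ l -ℤ + 1) *ℤ a +ℤ + l *ℤ ((+ 1 -ℤ I) -ℤ a)
    ≡⟨ collect (+ l) I a ⟩
  + l -ℤ a
    ∎
  where
  open ≡-Reasoning
  l∸1≡l-1 : + (l ∸ 1) ≡ + l -ℤ + 1
  l∸1≡l-1 = sym (trans (ℤP.m-n≡m⊖n l 1) (ℤP.⊖-≥ 1≤l))
  collect : ∀ L I a → L *ℤ I +ℤ (L -ℤ + 1) *ℤ a +ℤ L *ℤ ((+ 1 -ℤ I) -ℤ a) ≡ L -ℤ a
  collect = solve-∀

D₁-isDSRG : (l s : ℕ) → 1 ≤ l →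
  (blk : Fin (l * s + 1) → Fin (l * s + 1) → Fin s) →
  (∀ i g → countFin (inBlock blk i g) ≡ l) →
  IsDSRGOn (Fin (l * s + 1) × Fin s) (D₁ blk) ((l * s + 1) * s) (l * s) l (l ∸ 1) l
D₁-isDSRG l s 1≤l blk |B|≡l =
  *↔× , (λ x → D₁-irreflexive blk (remQuot s x))
      , (λ x _ → trans (outDegree blk (remQuot s x)) ls+1-1)
      , (λ _ y → inDegreeˡˢ (remQuot s y))
      , (λ x y → squareᵢⱼ (remQuot s x) (remQuot s y) (IMat ((l * s + 1) * s) x y))
  where
  ls+1-1 : + (l * s + 1) -ℤ + 1 ≡ + (l * s) *ℤ + 1
  ls+1-1 = begin
    + (l * s + 1) -ℤ + 1      ≡⟨ cong (_-ℤ + 1) (ℤP.pos-+ (l * s) 1) ⟩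
    + (l * s) +ℤ + 1 -ℤ + 1   ≡⟨ cancel (+ (l * s)) ⟩
    + (l * s) *ℤ + 1          ∎
    where
    open ≡-Reasoning
    cancel : ∀ a → a +ℤ + 1 -ℤ + 1 ≡ a *ℤ + 1
    cancel = solve-∀

  inDegreeˡˢ : ∀ y →
    sumFin (λ z → + 1 *ℤ ι (D₁ blk (remQuot s z) y)) ≡ + (l * s) *ℤ + 1
  inDegreeˡˢ (k , f) = begin
    sumFin (λ z → + 1 *ℤ ι (D₁ blk (remQuot s z) (k , f))) ≡⟨ inDegree blk k f ⟩
    + s *ℤ + countFin (inBlock blk k f)                    ≡⟨ cong (λ c → + s *ℤ + c) (|B|≡l k f) ⟩
    + s *ℤ + l                                             ≡⟨ ℤP.*-comm (+ s) (+ l) ⟩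
    + l *ℤ + s                                             ≡⟨ sym (ℤP.pos-* l s) ⟩
    + (l * s)                                              ≡⟨ sym (ℤP.*-identityʳ (+ (l * s))) ⟩
    + (l * s) *ℤ + 1                                       ∎
    where open ≡-Reasoning

  squareᵢⱼ : ∀ x y (I : ℤ) →
    sumFin (λ z → ι (D₁ blk x (remQuot s z)) *ℤ ι (D₁ blk (remQuot s z) y))
      ≡ + l *ℤ I +ℤ + (l ∸ 1) *ℤ ι (D₁ blk x y) +ℤ + l *ℤ ((+ 1 -ℤ I) -ℤ ι (D₁ blk x y))
  squareᵢⱼ x (k , f) I = begin
    sumFin (λ z → ι (D₁ blk x (remQuot s z)) *ℤ ι (D₁ blk (remQuot s z) (k , f)))
      ≡⟨ twoPaths blk x k f ⟩
    + countFin (inBlock blk k f) -ℤ a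
      ≡⟨ cong (λ c → + c -ℤ a) (|B|≡l k f) ⟩
    + l -ℤ a
      ≡⟨ sym (squareRHS l 1≤l I a) ⟩
    + l *ℤ I +ℤ + (l ∸ 1) *ℤ a +ℤ + l *ℤ ((+ 1 -ℤ I) -ℤ a)
      ∎
    where
    open ≡-Reasoning
    a : ℤ
    a = ι (D₁ blk x (k , f))

-- Main theorem: D₁ is a DSRG with parameters (ls² + s, ls, l, l − 1, l);
-- the vertex count (ls + 1)·s of the enumeration is ls² + s.
mainTheorem9 : (l s : ℕ) → 1 ≤ l → 1 ≤ s →
    (blk : Fin (l * s + 1) → Fin (l * s + 1) → Fin s) →
    (∀ i g → countFin (inBlock blk i g) ≡ l) →
    IsDSRGOn (Fin (l * s + 1) × Fin s) (D₁ blk)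
      (l * s * s + s) (l * s) l (l ∸ 1) l
mainTheorem9 l s 1≤l _ blk |B|≡l =
  subst (λ v → IsDSRGOn (Fin (l * s + 1) × Fin s) (D₁ blk) v (l * s) l (l ∸ 1) l)
        vertexCount (D₁-isDSRG l s 1≤l blk |B|≡l)
  where
  vertexCount : (l * s + 1) * s ≡ l * s * s + s
  vertexCount = trans (ℕP.*-distribʳ-+ s (l * s) 1) (cong (λ m → l * s * s + m) (ℕP.*-identityˡ s))
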